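{- Let $m<n$ be two positive integers. Then \[ T(n,n-m-1)=\#\{\sigma\in SP_n \mid \operatorname{seg}(\sigma)+\operatorname{des}(\sigma)=m\}. \]
   Context: A segmented permutation of size $n$ is a permutation $\sigma=\sigma_1\cdots\sigma_n$ of $\{1,\dots,n\}$, written as a word, together with a choice, for each position $i\in\{1,\dots,n-1\}$, of whether or not a bar is placed between $\sigma_i$ and $\sigma_{i+1}$. $SP_n$ denotes the set of segmented permutations of size $n$. A position $i<n$ is a segmentation of $\sigma$ if there is a bar between $\sigma_i$ and $\sigma_{i+1}$. It is a descent of $\sigma$ if it is not a segmentation and $\sigma_i>\sigma_{i+1}$. $\operatorname{des}(\sigma)$ is the number of descents and $\operatorname{seg}(\sigma)$ the number of segmentations (bars). For $n\ge 0$ and $k\ge0$, $T(n,k)=\#\{\sigma\in SP_n\mid \operatorname{des}(\sigma)=k\}$. -}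

module Defs where

open import Data.Nat using (ℕ; zero; suc; _+_; _<ᵇ_; pred)
open import Data.Bool using (Bool; true; false; not; _∧_; _∨_; if_then_else_; T)
open import Data.Fin using (Fin; toℕ; _≟_)
open import Data.Vec using (Vec; []; _∷_)
open import Data.Product using (Σ; _×_; proj₁; proj₂)
open import Relation.Nullary.Decidable using (⌊_⌋)

occurs : ∀ {n k} → Fin n → Vec (Fin n) k → Bool
occurs x []       = false
occurs x (y ∷ ys) = ⌊ x ≟ y ⌋ ∨ occurs x ys

allDistinct : ∀ {n k} → Vec (Fin n) k → Bool
allDistinct []       = true
allDistinct (x ∷ xs) = not (occurs x xs) ∧ allDistinct xs

-- A permutation of size n, written as a word σ₁⋯σₙ over {0,…,n-1}
-- (i.e. values shifted down by one): a word of length n with distinct letters.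
-- `T b` is proof-irrelevant, so equality of permutations is equality of words.
Perm : ℕ → Set
Perm n = Σ (Vec (Fin n) n) (λ w → T (allDistinct w))

-- Bars: entry i (0-indexed) of the bar vector says whether there is a bar
-- between σ_{i+1} and σ_{i+2}; there are n-1 such positions.
Bars : ℕ → Set
Bars n = Vec Bool (pred n)

SP : ℕ → Set
SP n = Perm n × Bars n

countTrue : ∀ {k} → Vec Bool k → ℕ
countTrue []           = 0
countTrue (true ∷ bs)  = suc (countTrue bs)
countTrue (false ∷ bs) = countTrue bs

desAux : ∀ {n k} → Vec (Fin n) (suc k) → Vec Bool k → ℕ
desAux (x ∷ [])     []       = 0
desAux (x ∷ y ∷ xs) (b ∷ bs) =
  (if not b ∧ (toℕ y <ᵇ toℕ x) then 1 else 0) + desAux (y ∷ xs) bs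

desW : ∀ {n} → Vec (Fin n) n → Bars n → ℕ
desW {zero}  []  _  = 0
desW {suc n} w   bs = desAux w bs

seg : ∀ {n} → SP n → ℕ
seg σ = countTrue (proj₂ σ)

des : ∀ {n} → SP n → ℕ
des σ = desW (proj₁ (proj₁ σ)) (proj₂ σ)

-- The proof uses the complement involution σ ↦ σᶜ, which replaces every letter
-- i of the word by n-1-i and keeps the bars.  At a position without a bar the
-- letters σᵢ ≠ σᵢ₊₁ form a descent in exactly one of σ and σᶜ, while a barred
-- position is a descent of neither.  Summing over the n-1 positions gives the
-- balance identity
--     des σ + (seg σ + des σᶜ) = n - 1.
-- Hence des σ = n-m-1 holds exactly when seg σᶜ + des σᶜ = m (seg σᶜ = seg σ),
-- and the involution restricts to the required bijection.
module Submission where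

open import Defs
open import Data.Nat using (ℕ; zero; suc; _+_; _∸_; _<_; _≤_; _<ᵇ_; s≤s)
open import Data.Nat.Properties
  using (<-cmp; <⇒<ᵇ; <ᵇ⇒<; <-asym; ∸-monoʳ-<; ∸-+-assoc; +-comm; +-suc;
         m+n∸n≡m; m+[n∸m]≡n; +-cancelʳ-≡; ≡-irrelevant)
open import Data.Nat.Tactic.RingSolver using (solve-∀)
open import Data.Product using (Σ; _,_; proj₁)
open import Data.Bool using (Bool; true; false; not; _∧_; _∨_; if_then_else_; T)
open import Data.Bool.Properties using (T-irrelevant)
open import Data.Fin using (Fin; toℕ; opposite) renaming (_≟_ to _≟ᶠ_)
open import Data.Fin.Properties using (opposite-prop; opposite-involutive; toℕ-injective; toℕ<n)
open import Data.Vec using (Vec; []; _∷_; map)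
open import Data.Empty using (⊥-elim)
open import Function.Bundles using (_↔_; _⇔_; mk↔ₛ′; mk⇔; Equivalence)
open import Relation.Binary using (tri<; tri≈; tri>)
open import Relation.Binary.PropositionalEquality
  using (_≡_; refl; sym; trans; cong; cong₂; subst; module ≡-Reasoning)
open import Relation.Nullary using (¬_; yes; no; Irrelevant)
open import Relation.Nullary.Decidable using (⌊_⌋)

module Relabel {n : ℕ} (f : Fin n → Fin n) (f-injective : ∀ {x y} → f x ≡ f y → x ≡ y) where

  test-relabel : ∀ x y → ⌊ f x ≟ᶠ f y ⌋ ≡ ⌊ x ≟ᶠ y ⌋
  test-relabel x y with x ≟ᶠ y | f x ≟ᶠ f y
  ... | yes _    | yes _   = refl
  ... | yes refl | no fx≢fx = ⊥-elim (fx≢fx refl)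
  ... | no x≢y   | yes fx≡fy = ⊥-elim (x≢y (f-injective fx≡fy))
  ... | no _     | no _    = refl

  occurs-relabel : ∀ {k} x (ys : Vec (Fin n) k) → occurs (f x) (map f ys) ≡ occurs x ys
  occurs-relabel x []       = refl
  occurs-relabel x (y ∷ ys) = cong₂ _∨_ (test-relabel x y) (occurs-relabel x ys)

  allDistinct-relabel : ∀ {k} (w : Vec (Fin n) k) → allDistinct (map f w) ≡ allDistinct w
  allDistinct-relabel []      = refl
  allDistinct-relabel (x ∷ w) =
    cong₂ (λ occ rest → not occ ∧ rest) (occurs-relabel x w) (allDistinct-relabel w)

distinct-tail : ∀ {n k} (x : Fin n) (w : Vec (Fin n) k) → T (allDistinct (x ∷ w)) → T (allDistinct w)
distinct-tail x w distinct with occurs x w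
... | false = distinct
... | true  = ⊥-elim distinct

distinct-head : ∀ {n k} (x y : Fin n) (w : Vec (Fin n) k) → T (allDistinct (x ∷ y ∷ w)) → ¬ x ≡ y
distinct-head x .x w distinct refl with x ≟ᶠ x
... | yes _   = distinct
... | no x≢x = x≢x refl

Perm-≡ : ∀ {n} {π π′ : Perm n} → proj₁ π ≡ proj₁ π′ → π ≡ π′
Perm-≡ {π = w , d} {π′ = .w , d′} refl = cong (w ,_) (T-irrelevant d d′)

complementWord : ∀ {n k} → Vec (Fin n) k → Vec (Fin n) k
complementWord = map opposite

complementWord-involutive : ∀ {n k} (w : Vec (Fin n) k) → complementWord (complementWord w) ≡ w
complementWord-involutive []      = refl
complementWord-involutive (x ∷ w) = cong₂ _∷_ (opposite-involutive x) (complementWord-involutive w)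

allDistinct-complement : ∀ {n k} (w : Vec (Fin n) k) → allDistinct (complementWord w) ≡ allDistinct w
allDistinct-complement {n} = Relabel.allDistinct-relabel opposite opposite-injective
  where
  opposite-injective : ∀ {x y : Fin n} → opposite x ≡ opposite y → x ≡ y
  opposite-injective {x} {y} eq =
    trans (sym (opposite-involutive x)) (trans (cong opposite eq) (opposite-involutive y))

complement : ∀ {n} → SP n → SP n
complement ((w , distinct) , bars) =
  (complementWord w , subst T (sym (allDistinct-complement w)) distinct) , bars

complement-involutive : ∀ {n} (σ : SP n) → complement (complement σ) ≡ σ
complement-involutive ((w , _) , bars) =
  cong (_, bars) (Perm-≡ (complementWord-involutive w))

indicator : Bool → ℕ
indicator b = if b then 1 else 0

indicator-true : ∀ {a b} → a < b → indicator (a <ᵇ b) ≡ 1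
indicator-true {a} {b} a<b with a <ᵇ b in eq
... | true  = refl
... | false = ⊥-elim (subst T eq (<⇒<ᵇ a<b))

indicator-false : ∀ {a b} → b < a → indicator (a <ᵇ b) ≡ 0
indicator-false {a} {b} b<a with a <ᵇ b in eq
... | false = refl
... | true  = ⊥-elim (<-asym b<a (<ᵇ⇒< a b (subst T (sym eq) _)))

opposite-reverses-< : ∀ {n} {x y : Fin n} → toℕ x < toℕ y → toℕ (opposite y) < toℕ (opposite x)
opposite-reverses-< {x = x} {y} x<y rewrite opposite-prop x | opposite-prop y =
  ∸-monoʳ-< (s≤s x<y) (toℕ<n y)

descent-in-exactly-one : ∀ {n} (x y : Fin n) → ¬ x ≡ y →
  indicator (toℕ y <ᵇ toℕ x) + indicator (toℕ (opposite y) <ᵇ toℕ (opposite x)) ≡ 1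
descent-in-exactly-one x y x≢y with <-cmp (toℕ x) (toℕ y)
... | tri< x<y _ _ rewrite indicator-false x<y | indicator-true (opposite-reverses-< x<y) = refl
... | tri≈ _ x≡y _ = ⊥-elim (x≢y (toℕ-injective x≡y))
... | tri> _ _ y<x rewrite indicator-true y<x | indicator-false (opposite-reverses-< y<x) = refl

regroup : ∀ e e′ d c d′ → (e + d) + (c + (e′ + d′)) ≡ (e + e′) + (d + (c + d′))
regroup = solve-∀

balance-word : ∀ {n k} (w : Vec (Fin n) (suc k)) (bars : Vec Bool k) → T (allDistinct w) →
  desAux w bars + (countTrue bars + desAux (complementWord w) bars) ≡ k
balance-word (x ∷ [])     []             _        = refl
balance-word {k = suc k} (x ∷ y ∷ w) (b ∷ bars) distinct = step b
  where
  open ≡-Reasoning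
  e  = indicator (toℕ y <ᵇ toℕ x)
  e′ = indicator (toℕ (opposite y) <ᵇ toℕ (opposite x))
  d  = desAux (y ∷ w) bars
  c  = countTrue bars
  d′ = desAux (complementWord (y ∷ w)) bars
  rest : d + (c + d′) ≡ k
  rest = balance-word (y ∷ w) bars (distinct-tail x (y ∷ w) distinct)
  step : ∀ b → desAux (x ∷ y ∷ w) (b ∷ bars)
                + (countTrue (b ∷ bars) + desAux (complementWord (x ∷ y ∷ w)) (b ∷ bars)) ≡ suc k
  step true = begin
    d + (suc c + d′)   ≡⟨ +-suc d (c + d′) ⟩
    suc (d + (c + d′)) ≡⟨ cong suc rest ⟩
    suc k              ∎
  step false = begin
    (e + d) + (c + (e′ + d′)) ≡⟨ regroup e e′ d c d′ ⟩
    (e + e′) + (d + (c + d′)) ≡⟨ cong (_+ (d + (c + d′))) (descent-in-exactly-one x y (distinct-head x y w distinct)) ⟩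
    suc (d + (c + d′))        ≡⟨ cong suc rest ⟩
    suc k                     ∎

balance : ∀ {n} (σ : SP n) → des σ + (seg σ + des (complement σ)) ≡ n ∸ 1
balance {zero}  (([] , _) , [])       = refl
balance {suc _} ((w , distinct) , bars) = balance-word w bars distinct

Σ-≡ : ∀ {A : Set} {R : A → Set} → (∀ {a} → Irrelevant (R a)) →
  ∀ {a a′} {r : R a} {r′ : R a′} → a ≡ a′ → (a , r) ≡ (a′ , r′)
Σ-≡ R-irrelevant {a} {r = r} {r′} refl = cong (a ,_) (R-irrelevant r r′)

module _ {A : Set} {P Q : A → Set}
         (P-irrelevant : ∀ {a} → Irrelevant (P a)) (Q-irrelevant : ∀ {a} → Irrelevant (Q a)) where

  involution-Σ-↔ : (f : A → A) → (∀ a → f (f a) ≡ a) → (∀ a → P a ⇔ Q (f a)) → Σ A P ↔ Σ A Q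
  involution-Σ-↔ f f-involutive P⇔Qf = mk↔ₛ′ to from
    (λ { (b , _) → Σ-≡ Q-irrelevant (f-involutive b) })
    (λ { (a , _) → Σ-≡ P-irrelevant (f-involutive a) })
    where
    to : Σ A P → Σ A Q
    to (a , p) = f a , Equivalence.to (P⇔Qf a) p
    from : Σ A Q → Σ A P
    from (b , q) = f b , Equivalence.from (P⇔Qf (f b)) (subst Q (sym (f-involutive b)) q)

complementary-counts : ∀ {d x m n} → d + x ≡ n ∸ 1 → m < n → (d ≡ n ∸ m ∸ 1 ⇔ x ≡ m)
complementary-counts {d} {x} {m} {suc k} d+x≡k (s≤s m≤k) = mk⇔ forward backward
  where
  open ≡-Reasoning
  target : suc k ∸ m ∸ 1 ≡ k ∸ m
  target = trans (∸-+-assoc (suc k) m 1) (cong (suc k ∸_) (+-comm m 1))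
  forward : d ≡ suc k ∸ m ∸ 1 → x ≡ m
  forward d≡ = +-cancelʳ-≡ d x m (begin
    x + d       ≡⟨ +-comm x d ⟩
    d + x       ≡⟨ d+x≡k ⟩
    k           ≡⟨ sym (m+[n∸m]≡n m≤k) ⟩
    m + (k ∸ m) ≡⟨ cong (m +_) (sym (trans d≡ target)) ⟩
    m + d      ∎)
  backward : x ≡ m → d ≡ suc k ∸ m ∸ 1
  backward refl = begin
    d           ≡⟨ sym (m+n∸n≡m d x) ⟩
    d + x ∸ x   ≡⟨ cong (_∸ x) d+x≡k ⟩
    k ∸ x       ≡⟨ sym target ⟩
    suc k ∸ x ∸ 1 ∎

-- The theorem.  The complement involution, restricted via the balance
-- identity.

mainTheorem1 : (m n : ℕ) → 1 ≤ m → m < n →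
    (Σ (SP n) (λ σ → des σ ≡ n ∸ m ∸ 1)) ↔ (Σ (SP n) (λ σ → seg σ + des σ ≡ m))
mainTheorem1 m n _ m<n =
  involution-Σ-↔ ≡-irrelevant ≡-irrelevant complement complement-involutive
    (λ σ → complementary-counts (balance σ) m<n)
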